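{- Let $k\geq 1$ and let $m,n$ be distinct odd positive integers with $m\leq k$ and $n\leq k$. Then $$\binom{m}{\frac{m+1}{2}}\binom{2k-m}{k-\frac{m+1}{2}} \neq \binom{n}{\frac{n+1}{2}}\binom{2k-n}{k-\frac{n+1}{2}}.$$ -}

module Defs where

-- Write m = 2a + 1 and k = m + e. Then the product is c(a) · c(a + e), where c(a) = C(2a+1, a+1),
-- and the two indices a, a + e have the fixed sum k − 1 with a ≤ a + e. The ratio
-- c(a+1)/c(a) = 2(2a+3)/(a+2) strictly increases with a, so c is strictly log-convex; hence
-- c(a) · c(s − a) strictly decreases as a grows towards s/2, and different a give different values.
module Submission where

open import Defs
open import Data.Nat using (ℕ; zero; suc; _+_; _*_; _∸_; _!; _≤_; _<_; s≤s; z≤n; NonZero)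
open import Data.Nat.Properties
open import Data.Nat.DivMod using (_/_; m/n*n≡m; m*n/n≡m)
open import Data.Nat.Combinatorics using (_C_; nCk≡n!/k![n-k]!; k![n∸k]!∣n!; nCk≡nC[n∸k])
open import Data.Nat.Tactic.RingSolver using (solve-∀)
open import Data.Product using (∃; _,_)
open import Function using (_∘_)
open import Relation.Binary.Definitions using (tri<; tri≈; tri>)
open import Relation.Binary.PropositionalEquality
  using (_≡_; _≢_; refl; sym; trans; cong; cong₂; subst; subst₂; ≢-sym; module ≡-Reasoning)
open import Relation.Nullary using (contradiction)
import Algebra.Properties.CommutativeSemigroup as CommutativeSemigroupProperties

nCk*k!*[n∸k]!≡n! : ∀ {n k} → k ≤ n → (n C k) * (k ! * (n ∸ k) !) ≡ n !
nCk*k!*[n∸k]!≡n! {n} {k} k≤n =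
  trans (cong (_* (k ! * (n ∸ k) !)) (nCk≡n!/k![n-k]! k≤n))
        (m/n*n≡m {{m*n≢0 (k !) ((n ∸ k) !) {{k !≢0}} {{(n ∸ k) !≢0}}}} (k![n∸k]!∣n! k≤n))

central : ℕ → ℕ
central a = suc (2 * a) C suc a

central*factorials : ∀ a → central a * (suc a ! * a !) ≡ suc (2 * a) !
central*factorials a =
  subst (λ r → central a * (suc a ! * r !) ≡ suc (2 * a) !) [2a+1]∸[a+1]≡a
        (nCk*k!*[n∸k]!≡n! (s≤s (m≤m+n a (1 * a))))
  where
  [2a+1]∸[a+1]≡a : suc (2 * a) ∸ suc a ≡ a
  [2a+1]∸[a+1]≡a = trans (m+n∸m≡n a (1 * a)) (*-identityˡ a)

central-nonZero : ∀ a → NonZero (central a)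
central-nonZero a = m*n≢0⇒m≢0 (central a) {{subst NonZero (sym (central*factorials a)) (suc (2 * a) !≢0)}}

central-suc : ∀ a → central (suc a) * (2 + a) ≡ 2 * (3 + 2 * a) * central a
central-suc a = *-cancelʳ-≡ _ _ (suc a ! * suc a !) {{m*n≢0 _ _ {{suc a !≢0}} {{suc a !≢0}}}} (begin
    central (suc a) * (2 + a) * (suc a ! * suc a !)
  ≡⟨ *-assoc (central (suc a)) (2 + a) _ ⟩
    central (suc a) * ((2 + a) * (suc a ! * suc a !))
  ≡⟨ cong (central (suc a) *_) (sym (*-assoc (2 + a) (suc a !) (suc a !))) ⟩
    central (suc a) * (suc (suc a) ! * suc a !)
  ≡⟨ central*factorials (suc a) ⟩
    suc (2 * suc a) !
  ≡⟨ cong (λ r → suc r !) (2[1+a]≡2+2a a) ⟩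
    (3 + 2 * a) * ((2 + 2 * a) * suc (2 * a) !)
  ≡⟨ cong (λ r → (3 + 2 * a) * ((2 + 2 * a) * r)) (sym (central*factorials a)) ⟩
    (3 + 2 * a) * ((2 + 2 * a) * (central a * ((1 + a) * a ! * a !)))
  ≡⟨ regroup a (central a) (a !) ⟩
    2 * (3 + 2 * a) * central a * ((1 + a) * a ! * ((1 + a) * a !))
  ∎)
  where
  open ≡-Reasoning
  2[1+a]≡2+2a : ∀ a → 2 * suc a ≡ suc (suc (2 * a))
  2[1+a]≡2+2a = solve-∀
  regroup : ∀ a c f → (3 + 2 * a) * ((2 + 2 * a) * (c * ((1 + a) * f * f)))
                    ≡ 2 * (3 + 2 * a) * c * ((1 + a) * f * ((1 + a) * f))
  regroup = solve-∀

[3+2a][2+j]<[3+2j][2+a] : ∀ {a j} → a < j → (3 + 2 * a) * (2 + j) < (3 + 2 * j) * (2 + a)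
[3+2a][2+j]<[3+2j][2+a] {a} a<j with m≤n⇒∃[o]m+o≡n a<j
... | d , refl = subst ((3 + 2 * a) * (2 + suc (a + d)) <_) (sym (expand a d)) (m<m+n _ {suc d} (s≤s z≤n))
  where
  expand : ∀ a d → (3 + 2 * suc (a + d)) * (2 + a) ≡ (3 + 2 * a) * (2 + suc (a + d)) + suc d
  expand = solve-∀

central-suc-scaled : ∀ a j → central (suc a) * central j * ((2 + a) * (2 + j))
                           ≡ 2 * (central a * central j) * ((3 + 2 * a) * (2 + j))
central-suc-scaled a j = begin
    central (suc a) * central j * ((2 + a) * (2 + j))
  ≡⟨ interchange (central (suc a)) (central j) (2 + a) (2 + j) ⟩
    central (suc a) * (2 + a) * (central j * (2 + j))
  ≡⟨ cong (_* (central j * (2 + j))) (central-suc a) ⟩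
    2 * (3 + 2 * a) * central a * (central j * (2 + j))
  ≡⟨ regroup a j (central a) (central j) ⟩
    2 * (central a * central j) * ((3 + 2 * a) * (2 + j))
  ∎
  where
  open ≡-Reasoning
  open CommutativeSemigroupProperties *-commutativeSemigroup using (interchange)
  regroup : ∀ a j c d → 2 * (3 + 2 * a) * c * (d * (2 + j)) ≡ 2 * (c * d) * ((3 + 2 * a) * (2 + j))
  regroup = solve-∀

central-logConvex : ∀ {a j} → a < j → central (suc a) * central j < central a * central (suc j)
central-logConvex {a} {j} a<j = *-cancelʳ-< ((2 + a) * (2 + j)) _ _ (begin-strict
    central (suc a) * central j * ((2 + a) * (2 + j))
  ≡⟨ central-suc-scaled a j ⟩
    2 * (central a * central j) * ((3 + 2 * a) * (2 + j))
  <⟨ *-monoʳ-< (2 * (central a * central j)) {{positive}} ([3+2a][2+j]<[3+2j][2+a] a<j) ⟩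
    2 * (central a * central j) * ((3 + 2 * j) * (2 + a))
  ≡⟨ cong (λ p → 2 * p * ((3 + 2 * j) * (2 + a))) (*-comm (central a) (central j)) ⟩
    2 * (central j * central a) * ((3 + 2 * j) * (2 + a))
  ≡⟨ central-suc-scaled j a ⟨
    central (suc j) * central a * ((2 + j) * (2 + a))
  ≡⟨ cong₂ _*_ (*-comm (central (suc j)) (central a)) (*-comm (2 + j) (2 + a)) ⟩
    central a * central (suc j) * ((2 + a) * (2 + j))
  ∎)
  where
  open ≤-Reasoning
  positive : NonZero (2 * (central a * central j))
  positive = m*n≢0 2 _ {{_}} {{m*n≢0 _ _ {{central-nonZero a}} {{central-nonZero j}}}}

central-product-spread : ∀ d {a j} → suc (d + a) ≤ j
                       → central (suc (d + a)) * central j < central a * central (suc (d + j))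
central-product-spread zero    a<j = central-logConvex a<j
central-product-spread (suc d) {a} {j} d+a<j = begin-strict
    central (suc (suc d + a)) * central j
  <⟨ central-logConvex d+a<j ⟩
    central (suc (d + a)) * central (suc j)
  <⟨ central-product-spread d (m≤n⇒m≤1+n (<⇒≤ d+a<j)) ⟩
    central a * central (suc (d + suc j))
  ≡⟨ cong (λ i → central a * central (suc i)) (+-suc d j) ⟩
    central a * central (suc (suc d + j))
  ∎
  where open ≤-Reasoning

central-product-< : ∀ {a b e e′} → a < b → 2 * b + 1 + e′ ≡ 2 * a + 1 + e
                  → central b * central (b + e′) < central a * central (a + e)
central-product-< {a} {_} {e} {e′} a<b same-k with m≤n⇒∃[o]m+o≡n a<b
... | d , refl = subst₂ _<_
  (cong (λ i → central i * central (i + e′)) (cong suc (+-comm d a)))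
  (cong (λ i → central a * central i) far-index)
  (central-product-spread d (m≤m+n (suc (d + a)) e′))
  where
  open ≡-Reasoning
  far-index : suc (d + (suc (d + a) + e′)) ≡ a + e
  far-index = +-cancelˡ-≡ (suc a) _ _ (begin
      suc a + suc (d + (suc (d + a) + e′))  ≡⟨ expand₁ a d e′ ⟩
      2 * suc (a + d) + 1 + e′              ≡⟨ same-k ⟩
      2 * a + 1 + e                         ≡⟨ expand₂ a e ⟩
      suc a + (a + e)                       ∎)
    where
    expand₁ : ∀ a d e′ → suc a + suc (d + (suc (d + a) + e′)) ≡ 2 * suc (a + d) + 1 + e′
    expand₁ = solve-∀
    expand₂ : ∀ a e → 2 * a + 1 + e ≡ suc a + (a + e)
    expand₂ = solve-∀

central-sym : ∀ j → suc (2 * j) C j ≡ central j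
central-sym j = trans (nCk≡nC[n∸k] (m≤n⇒m≤1+n (m≤m+n j (1 * j))))
                      (cong (suc (2 * j) C_) [1+2j]∸j≡1+j)
  where
  [1+2j]∸j≡1+j : suc (2 * j) ∸ j ≡ suc j
  [1+2j]∸j≡1+j = trans (cong (_∸ j) (split j)) (m+n∸n≡m (suc j) j)
    where
    split : ∀ j → suc (2 * j) ≡ suc j + j
    split = solve-∀

binomialProduct : ℕ → ℕ → ℕ
binomialProduct m k = (m C ((m + 1) / 2)) * ((2 * k ∸ m) C (k ∸ ((m + 1) / 2)))

binomialProduct-odd : ∀ a e → binomialProduct (2 * a + 1) (2 * a + 1 + e) ≡ central a * central (a + e)
binomialProduct-odd a e = begin
    (m C ((m + 1) / 2)) * ((2 * k ∸ m) C (k ∸ ((m + 1) / 2)))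
  ≡⟨ cong (λ h → (m C h) * ((2 * k ∸ m) C (k ∸ h))) [m+1]/2≡1+a ⟩
    (m C suc a) * ((2 * k ∸ m) C (k ∸ suc a))
  ≡⟨ cong₂ _*_ (cong (_C suc a) (+-comm (2 * a) 1)) (cong₂ _C_ 2k∸m≡1+2[a+e] k∸[1+a]≡a+e) ⟩
    central a * (suc (2 * (a + e)) C (a + e))
  ≡⟨ cong (central a *_) (central-sym (a + e)) ⟩
    central a * central (a + e)
  ∎
  where
  open ≡-Reasoning
  m = 2 * a + 1
  k = m + e
  [m+1]/2≡1+a : (m + 1) / 2 ≡ suc a
  [m+1]/2≡1+a = trans (cong (_/ 2) (double a)) (m*n/n≡m (suc a) 2)
    where
    double : ∀ a → 2 * a + 1 + 1 ≡ suc a * 2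
    double = solve-∀
  2k∸m≡1+2[a+e] : 2 * k ∸ m ≡ suc (2 * (a + e))
  2k∸m≡1+2[a+e] = trans (cong (_∸ m) (split a e)) (m+n∸m≡n m _)
    where
    split : ∀ a e → 2 * (2 * a + 1 + e) ≡ (2 * a + 1) + suc (2 * (a + e))
    split = solve-∀
  k∸[1+a]≡a+e : k ∸ suc a ≡ a + e
  k∸[1+a]≡a+e = trans (cong (_∸ suc a) (split a e)) (m+n∸m≡n (suc a) (a + e))
    where
    split : ∀ a e → 2 * a + 1 + e ≡ suc a + (a + e)
    split = solve-∀

central-products-≢ : ∀ {a b e e′} → a ≢ b → 2 * b + 1 + e′ ≡ 2 * a + 1 + e
                   → central a * central (a + e) ≢ central b * central (b + e′)
central-products-≢ {a} {b} a≢b same-k with <-cmp a b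
... | tri< a<b _ _ = ≢-sym (<⇒≢ (central-product-< a<b same-k))
... | tri≈ _ a≡b _ = contradiction a≡b a≢b
... | tri> _ _ b<a = <⇒≢ (central-product-< b<a (sym same-k))

lemma6 : (k m n : ℕ) → 1 ≤ k → (∃ λ a → m ≡ 2 * a + 1) → (∃ λ b → n ≡ 2 * b + 1)
    → m ≢ n → m ≤ k → n ≤ k
    → (m C ((m + 1) / 2)) * ((2 * k ∸ m) C (k ∸ ((m + 1) / 2)))
    ≢ (n C ((n + 1) / 2)) * ((2 * k ∸ n) C (k ∸ ((n + 1) / 2)))
lemma6 k m n _ (a , refl) (b , refl) m≢n m≤k n≤k with m≤n⇒∃[o]m+o≡n m≤k | m≤n⇒∃[o]m+o≡n n≤k
... | e , refl | e′ , same-k = λ products≡ →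
  central-products-≢ {a} {b} {e} {e′} (m≢n ∘ cong (λ x → 2 * x + 1)) same-k (begin
    central a * central (a + e)                  ≡⟨ binomialProduct-odd a e ⟨
    binomialProduct (2 * a + 1) (2 * a + 1 + e)  ≡⟨ products≡ ⟩
    binomialProduct (2 * b + 1) (2 * a + 1 + e)  ≡⟨ cong (binomialProduct (2 * b + 1)) same-k ⟨
    binomialProduct (2 * b + 1) (2 * b + 1 + e′) ≡⟨ binomialProduct-odd b e′ ⟩
    central b * central (b + e′)                 ∎)
  where open ≡-Reasoning
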